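{- Let $n\ge 6$ be an integer with $n\equiv 2\pmod 4$, let $B=\{v\in V(C_n\square K_2): x_v+y_v\equiv 1\pmod 2\}$, $A=V(C_n\square K_2)\setminus B$, and $Q=\{\{v,w\}\subseteq A: d_{C_n}(x_v,x_w)=3\}$. Let $\{v,w\}\in Q$ with $x_w=\langle x_v+3\rangle_n$, and let $l\in\{0,\dots,\lfloor n/4\rfloor-1\}$. If $\tilde v_l=(\langle x_v-2l\rangle_n,y_v)$ and $\tilde w_l=(\langle x_w+2l\rangle_n,y_w)$, then $B_{v|w}=B_{\tilde v_l|\tilde w_l}$.
   Context: $C_n$ is the cycle with vertex set $[n]=\{1,\dots,n\}$, where $i$ is adjacent to $i+1$ for $1\le i<n$ and $n$ is adjacent to $1$; $K_2$ has vertex set $\{1,2\}$. The Cartesian product $C_n\square K_2$ has vertex set $[n]\times\{1,2\}$, with $(g,h)\sim(g',h')$ iff either $g=g'$ and $hh'$ is an edge of $K_2$, or $h=h'$ and $gg'\in E(C_n)$. A vertex $v$ is written $v=(x_v,y_v)$. $d$ denotes the shortest-path distance in $C_n\square K_2$. For an integer $k$, $\langle k\rangle_n$ denotes the residue of $k$ modulo $n$, interpreted as a vertex of $C_n$ (residue $0$ corresponding to vertex $n$). The bisector of $v,w$ is $B_{v|w}=\{x: d(v,x)=d(w,x)\}$. -}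

module Defs where

open import Data.Nat using (ℕ; zero; suc; _+_; _∸_; _*_; _<_; _≤_; NonZero)
open import Data.Nat.DivMod using (_mod_; _%_)
open import Data.Fin using (Fin; toℕ)
open import Data.Product using (_×_; _,_; proj₁; proj₂; ∃-syntax)
open import Data.Sum using (_⊎_)
open import Relation.Binary.PropositionalEquality using (_≡_; _≢_)
open import Relation.Nullary using (¬_)

-- Convention: vertex i of C_n (i ∈ [n]) is represented by the element
-- of Fin n with value i - 1; likewise vertex j of K_2 by Fin 2 value j - 1.
-- Hence the paper label of x : Fin n is toℕ x + 1.

data Walk {V : Set} (adj : V → V → Set) : V → V → ℕ → Set where
  here : ∀ {u} → Walk adj u u zero
  step : ∀ {u v w k} → adj u v → Walk adj v w k → Walk adj u w (suc k)

IsDist : {V : Set} → (V → V → Set) → V → V → ℕ → Set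
IsDist adj u v k = Walk adj u v k × (∀ j → j < k → ¬ Walk adj u v j)

CycAdj : (n : ℕ) → ⦃ _ : NonZero n ⦄ → Fin n → Fin n → Set
CycAdj n g g' = (toℕ g' ≡ (toℕ g + 1) % n) ⊎ (toℕ g ≡ (toℕ g' + 1) % n)

K2Adj : Fin 2 → Fin 2 → Set
K2Adj h h' = h ≢ h'

Vtx : ℕ → Set
Vtx n = Fin n × Fin 2

PrismAdj : (n : ℕ) → ⦃ _ : NonZero n ⦄ → Vtx n → Vtx n → Set
PrismAdj n (g , h) (g' , h') = (g ≡ g' × K2Adj h h') ⊎ (h ≡ h' × CycAdj n g g')

CycDist : (n : ℕ) → ⦃ _ : NonZero n ⦄ → Fin n → Fin n → ℕ → Set
CycDist n = IsDist (CycAdj n)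

Dist : (n : ℕ) → ⦃ _ : NonZero n ⦄ → Vtx n → Vtx n → ℕ → Set
Dist n = IsDist (PrismAdj n)

InBisector : (n : ℕ) → ⦃ _ : NonZero n ⦄ → Vtx n → Vtx n → Vtx n → Set
InBisector n v w x = ∃[ k ] (Dist n v x k × Dist n w x k)

InA : (n : ℕ) → Vtx n → Set
InA n (x , y) = ((toℕ x + 1) + (toℕ y + 1)) % 2 ≡ 0

-- ⟨ x + k ⟩_n and ⟨ x - k ⟩_n (for k ≤ n) as vertices of C_n
shiftUp : (n : ℕ) → ⦃ _ : NonZero n ⦄ → Fin n → ℕ → Fin n
shiftUp n x k = (toℕ x + k) mod n

shiftDown : (n : ℕ) → ⦃ _ : NonZero n ⦄ → Fin n → ℕ → Fin n
shiftDown n x k = (toℕ x + (n ∸ k)) mod n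

module Submission where

-- In C_n □ K_2 the distance splits as d((g,h),(g',h')) = d_{C_n}(g,g') + [h ≠ h'].  Since n is
-- even and v, w ∈ A with x_w = x_v + 3, the vertices v and w lie in different layers, so
-- x = (t, z) ∈ B_{v|w} says that t is one step closer on the cycle to x_v than to x_w, or the
-- reverse, according to z.  For t at offset u from a = x_v and the pair p = a − s, q = a + 3 + s
-- with n = 6 + 2s + 4e, a case analysis over the arc containing t shows that t is one step closer
-- to p exactly when u ∈ {1, n/2 + 2}, and to q exactly when u ∈ {2, n/2 + 1}.  This does not
-- depend on s, and the theorem compares s = 0 with s = 2l.

open import Defs
open import Data.Nat
  using (ℕ; zero; suc; _+_; _∸_; _*_; _<_; _≤_; _⊓_; _<?_; NonZero; >-nonZero⁻¹; z≤n; s≤s)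
open import Data.Nat.Properties
open import Data.Nat.DivMod
  using (_%_; _/_; _mod_; m%n<n; m%n%n≡m%n; [m+n]%n≡m%n; %-distribˡ-+; m<n⇒m%n≡m; n%n≡0;
         m≡m%n+[m/n]*n; m∣n⇒o%n%m≡o%m)
open import Data.Fin using (Fin; toℕ; zero; suc)
open import Data.Fin.Properties using (toℕ-injective; toℕ<n; toℕ-fromℕ<)
open import Data.Product using (_×_; _,_; proj₁; proj₂; ∃-syntax)
open import Data.Nat.Divisibility using (_∣_; divides)
open import Data.Sum using (_⊎_; inj₁; inj₂)
open import Relation.Nullary using (Dec; yes; no; contradiction)
open import Relation.Binary.Definitions using (tri<; tri≈; tri>)
open import Relation.Binary.PropositionalEquality
open import Function.Bundles using (_⇔_; mk⇔; Equivalence)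
import Function.Properties.Equivalence as ⇔
open import Data.Nat.Tactic.RingSolver using (solve-∀; solve)
open import Data.List using (_∷_; [])
open import Algebra.Properties.CommutativeSemigroup +-commutativeSemigroup using (x∙yz≈y∙xz)

module _ {V : Set} {adj : V → V → Set} where

  walk-++ : ∀ {u v w j k} → Walk adj u v j → Walk adj v w k → Walk adj u w (j + k)
  walk-++ here q = q
  walk-++ (step e p) q = step e (walk-++ p q)

  walk-reverse : (∀ {a b} → adj a b → adj b a) → ∀ {u v k} → Walk adj u v k → Walk adj v u k
  walk-reverse adj-sym here = here
  walk-reverse adj-sym (step {k = k} e p) =
    subst (Walk adj _ _) (+-comm k 1) (walk-++ (walk-reverse adj-sym p) (step (adj-sym e) here))

  module _ (D : V → V → ℕ) (D-self : ∀ u → D u u ≡ 0)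
           (D-step : ∀ {p p'} q → adj p p' → D p q ≤ suc (D p' q))
           (D-walk : ∀ p q → Walk adj p q (D p q)) where

    D≤walk-length : ∀ {p q k} → Walk adj p q k → D p q ≤ k
    D≤walk-length {q = q} here = ≤-reflexive (D-self q)
    D≤walk-length {q = q} (step e w) = ≤-trans (D-step q e) (s≤s (D≤walk-length w))

    IsDist⇔≡ : ∀ {p q k} → IsDist adj p q k ⇔ (k ≡ D p q)
    IsDist⇔≡ {p} {q} {k} = mk⇔ to from
      where
      to : IsDist adj p q k → k ≡ D p q
      to (w , shortest) = ≤-antisym (≮⇒≥ λ lt → shortest _ lt (D-walk p q)) (D≤walk-length w)
      from : k ≡ D p q → IsDist adj p q k
      from refl = D-walk p q , λ j j<k w → <⇒≱ j<k (D≤walk-length w)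

bitDist : Fin 2 → Fin 2 → ℕ
bitDist zero       zero       = 0
bitDist zero       (suc zero) = 1
bitDist (suc zero) zero       = 1
bitDist (suc zero) (suc zero) = 0

bitDist-self : ∀ h → bitDist h h ≡ 0
bitDist-self zero       = refl
bitDist-self (suc zero) = refl

bitDist≤1 : ∀ h h' → bitDist h h' ≤ 1
bitDist≤1 zero       zero       = z≤n
bitDist≤1 zero       (suc zero) = ≤-refl
bitDist≤1 (suc zero) zero       = ≤-refl
bitDist≤1 (suc zero) (suc zero) = z≤n

+0ˡ-⇔ : ∀ {a b a' b'} → (a ≡ b + 1) ⇔ (a' ≡ b' + 1) → (a + 0 ≡ b + 1) ⇔ (a' + 0 ≡ b' + 1)
+0ˡ-⇔ {a} {a' = a'} P rewrite +-identityʳ a | +-identityʳ a' = P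

+0ʳ-⇔ : ∀ {a b a' b'} → (a + 1 ≡ b) ⇔ (a' + 1 ≡ b') → (a + 1 ≡ b + 0) ⇔ (a' + 1 ≡ b' + 0)
+0ʳ-⇔ {b = b} {b' = b'} P rewrite +-identityʳ b | +-identityʳ b' = P

bitDist-balance-transfer : ∀ {a b a' b'} {i j : Fin 2} → i ≢ j →
  (a + 1 ≡ b) ⇔ (a' + 1 ≡ b') → (a ≡ b + 1) ⇔ (a' ≡ b' + 1) →
  ∀ z → (a + bitDist i z ≡ b + bitDist j z) ⇔ (a' + bitDist i z ≡ b' + bitDist j z)
bitDist-balance-transfer {i = zero}     {zero}     i≢j _ _ = contradiction refl i≢j
bitDist-balance-transfer {i = suc zero} {suc zero} i≢j _ _ = contradiction refl i≢j
bitDist-balance-transfer {i = zero}     {suc zero} _ _ Q zero       = +0ˡ-⇔ Q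
bitDist-balance-transfer {i = zero}     {suc zero} _ P _ (suc zero) = +0ʳ-⇔ P
bitDist-balance-transfer {i = suc zero} {zero}     _ P _ zero       = +0ʳ-⇔ P
bitDist-balance-transfer {i = suc zero} {zero}     _ _ Q (suc zero) = +0ˡ-⇔ Q

module Residues (n : ℕ) ⦃ _ : NonZero n ⦄ where

  infix 4 _≋_
  _≋_ : ℕ → ℕ → Set
  x ≋ y = x % n ≡ y % n

  %-≋ : ∀ x → x % n ≋ x
  %-≋ x = m%n%n≡m%n x n

  +n-≋ : ∀ x → x + n ≋ x
  +n-≋ x = [m+n]%n≡m%n x n

  +-≋ : ∀ {x x' y y'} → x ≋ x' → y ≋ y' → x + y ≋ x' + y'
  +-≋ {x} {x'} {y} {y'} x≋x' y≋y' = begin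
    (x + y) % n             ≡⟨ %-distribˡ-+ x y n ⟩
    (x % n + y % n) % n     ≡⟨ cong₂ (λ a b → (a + b) % n) x≋x' y≋y' ⟩
    (x' % n + y' % n) % n   ≡⟨ %-distribˡ-+ x' y' n ⟨
    (x' + y') % n           ∎
    where open ≡-Reasoning

  +-≋ˡ : ∀ x {y y'} → y ≋ y' → x + y ≋ x + y'
  +-≋ˡ x = +-≋ {x} refl

  +-≋ʳ : ∀ {x x'} y → x ≋ x' → x + y ≋ x' + y
  +-≋ʳ y x≋x' = +-≋ {y = y} x≋x' refl

  +-cancelʳ-≋ : ∀ x y c → x + c ≋ y + c → x ≋ y
  +-cancelʳ-≋ x y c eq = begin
    x % n                         ≡⟨ +n-≋ x ⟨
    (x + n) % n                   ≡⟨ cong (_% n) (cong (x +_) c+c̄≡n) ⟨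
    (x + (c % n + c̄)) % n         ≡⟨ cong (_% n) (+-assoc x (c % n) c̄) ⟨
    (x + c % n + c̄) % n           ≡⟨ +-≋ʳ c̄ (+-≋ˡ x (%-≋ c)) ⟩
    (x + c + c̄) % n               ≡⟨ +-≋ʳ c̄ eq ⟩
    (y + c + c̄) % n               ≡⟨ +-≋ʳ c̄ (+-≋ˡ y (%-≋ c)) ⟨
    (y + c % n + c̄) % n           ≡⟨ cong (_% n) (+-assoc y (c % n) c̄) ⟩
    (y + (c % n + c̄)) % n         ≡⟨ cong (_% n) (cong (y +_) c+c̄≡n) ⟩
    (y + n) % n                   ≡⟨ +n-≋ y ⟩
    y % n                         ∎
    where
    open ≡-Reasoning
    c̄ = n ∸ c % n
    c+c̄≡n : c % n + c̄ ≡ n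
    c+c̄≡n = m+[n∸m]≡n (<⇒≤ (m%n<n c n))

  toℕ-mod : ∀ m → toℕ (m mod n) ≋ m
  toℕ-mod m = trans (cong (_% n) (toℕ-fromℕ< _)) (%-≋ m)

  toℕ≤n : (g : Fin n) → toℕ g ≤ n
  toℕ≤n g = <⇒≤ (toℕ<n g)

  ≋⇒≡ : ∀ {x y} → x < n → y < n → x ≋ y → x ≡ y
  ≋⇒≡ x<n y<n eq = trans (sym (m<n⇒m%n≡m x<n)) (trans eq (m<n⇒m%n≡m y<n))

  x%n+n≡x : ∀ {x} → n ≤ x → x < n + n → x % n + n ≡ x
  x%n+n≡x {x} n≤x x<2n = begin
    x % n + n             ≡⟨ cong (λ y → y % n + n) (m∸n+n≡m n≤x) ⟨
    (x ∸ n + n) % n + n   ≡⟨ cong (_+ n) (+n-≋ (x ∸ n)) ⟩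
    (x ∸ n) % n + n       ≡⟨ cong (_+ n) (m<n⇒m%n≡m (m<n+o⇒m∸n<o x n x<2n)) ⟩
    x ∸ n + n             ≡⟨ m∸n+n≡m n≤x ⟩
    x                     ∎
    where open ≡-Reasoning

  offset : ℕ → ℕ → ℕ
  offset a b = (b + (n ∸ a)) % n

  offset<n : ∀ a b → offset a b < n
  offset<n a b = m%n<n _ n

  offset-spec : ∀ {a} b → a ≤ n → a + offset a b ≋ b
  offset-spec {a} b a≤n = begin
    (a + (b + (n ∸ a)) % n) % n   ≡⟨ +-≋ˡ a (%-≋ (b + (n ∸ a))) ⟩
    (a + (b + (n ∸ a))) % n       ≡⟨ cong (_% n) (x∙yz≈y∙xz a b (n ∸ a)) ⟩
    (b + (a + (n ∸ a))) % n       ≡⟨ cong (λ m → (b + m) % n) (m+[n∸m]≡n a≤n) ⟩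
    (b + n) % n                   ≡⟨ +n-≋ b ⟩
    b % n                         ∎
    where open ≡-Reasoning

  offset-unique : ∀ {a b r} → a ≤ n → r < n → a + r ≋ b → offset a b ≡ r
  offset-unique {a} {b} {r} a≤n r<n eq = ≋⇒≡ (offset<n a b) r<n
    (+-cancelʳ-≋ _ _ a (trans (cong (_% n) (+-comm (offset a b) a))
      (trans (offset-spec b a≤n) (trans (sym eq) (cong (_% n) (+-comm a r))))))

  offset-shift : ∀ {a p} t c → a ≤ n → p ≤ n → c + p ≋ a → offset p t ≡ (offset a t + c) % n
  offset-shift {a} {p} t c a≤n p≤n c+p≋a = offset-unique p≤n (m%n<n _ n) (begin
    (p + (o + c) % n) % n   ≡⟨ +-≋ˡ p (%-≋ (o + c)) ⟩
    (p + (o + c)) % n       ≡⟨ cong (_% n) (rearrange p o c) ⟩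
    (c + p + o) % n         ≡⟨ +-≋ʳ o c+p≋a ⟩
    (a + o) % n             ≡⟨ offset-spec t a≤n ⟩
    t % n                   ∎)
    where
    open ≡-Reasoning
    o = offset a t
    rearrange : ∀ p o c → p + (o + c) ≡ c + p + o
    rearrange = solve-∀

  toℕ-shiftUp : ∀ x c → toℕ (shiftUp n x c) ≋ toℕ x + c
  toℕ-shiftUp x c = toℕ-mod (toℕ x + c)

  toℕ-shiftDown : ∀ x {c} → c ≤ n → c + toℕ (shiftDown n x c) ≋ toℕ x
  toℕ-shiftDown x {c} c≤n = begin
    (c + toℕ (shiftDown n x c)) % n   ≡⟨ +-≋ˡ c (toℕ-mod (toℕ x + (n ∸ c))) ⟩
    (c + (toℕ x + (n ∸ c))) % n       ≡⟨ cong (_% n) (x∙yz≈y∙xz c (toℕ x) (n ∸ c)) ⟩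
    (toℕ x + (c + (n ∸ c))) % n       ≡⟨ cong (λ m → (toℕ x + m) % n) (m+[n∸m]≡n c≤n) ⟩
    (toℕ x + n) % n                   ≡⟨ +n-≋ (toℕ x) ⟩
    toℕ x % n                         ∎
    where open ≡-Reasoning

  complement-≋ : ∀ {x a c} → c ≤ n → x ≋ a + c → (n ∸ c) + x ≋ a
  complement-≋ {x} {a} {c} c≤n x≋a+c = begin
    (n ∸ c + x) % n         ≡⟨ +-≋ˡ (n ∸ c) x≋a+c ⟩
    (n ∸ c + (a + c)) % n   ≡⟨ cong (_% n) (x∙yz≈y∙xz (n ∸ c) a c) ⟩
    (a + (n ∸ c + c)) % n   ≡⟨ cong (λ m → (a + m) % n) (m∸n+n≡m c≤n) ⟩
    (a + n) % n             ≡⟨ +n-≋ a ⟩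
    a % n                   ∎
    where open ≡-Reasoning

module Prism (n : ℕ) ⦃ _ : NonZero n ⦄ where
  open Residues n

  -- norm x is the cycle distance from 0 to x, for x ≤ n
  norm : ℕ → ℕ
  norm x = x ⊓ (n ∸ x)

  norm-low : ∀ {x} → x + x ≤ n → norm x ≡ x
  norm-low {x} x+x≤n = m≤n⇒m⊓n≡m (m+n≤o⇒m≤o∸n x x+x≤n)

  norm-high : ∀ {x} → n ≤ x + x → x ≤ n → norm x + x ≡ n
  norm-high {x} n≤x+x x≤n = trans (cong (_+ x) (m≥n⇒m⊓n≡n n∸x≤x)) (m∸n+n≡m x≤n)
    where
    n∸x≤x : n ∸ x ≤ x
    n∸x≤x = subst (n ∸ x ≤_) (m+n∸n≡m x x) (∸-monoˡ-≤ x n≤x+x)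

  norm-suc : ∀ {x} → x < n → norm x ≤ suc (norm (suc x % n)) × norm (suc x % n) ≤ suc (norm x)
  norm-suc {x} x<n with suc x <? n
  ... | yes sx<n rewrite m<n⇒m%n≡m sx<n =
      ⊓-mono-≤ (m≤n⇒m≤1+n (n≤1+n x)) (≤-reflexive (+-∸-assoc 1 x<n))
    , ⊓-mono-≤ ≤-refl (≤-trans (∸-monoʳ-≤ n (n≤1+n x)) (n≤1+n (n ∸ x)))
  ... | no sx≮n = subst (λ r → norm x ≤ suc (norm r) × norm r ≤ suc (norm x)) (sym sx%n≡0)
      (≤-trans (m⊓n≤n x (n ∸ x)) (≤-reflexive n∸x≡1) , z≤n)
    where
    sx≡n : suc x ≡ n
    sx≡n = ≤-antisym x<n (≮⇒≥ sx≮n)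
    sx%n≡0 : suc x % n ≡ 0
    sx%n≡0 = trans (cong (_% n) sx≡n) (n%n≡0 n)
    n∸x≡1 : n ∸ x ≡ 1
    n∸x≡1 = trans (cong (_∸ x) (sym sx≡n)) (m+n∸n≡m 1 x)

  cycleDist : Fin n → Fin n → ℕ
  cycleDist g h = norm (offset (toℕ g) (toℕ h))

  offset-adj : ∀ {g g' : Fin n} c → toℕ g' ≡ (toℕ g + 1) % n →
               offset (toℕ g) c ≡ suc (offset (toℕ g') c) % n
  offset-adj {g} {g'} c g'≡g+1 = offset-unique (toℕ≤n g) (m%n<n _ n) (begin
    (toℕ g + suc o' % n) % n   ≡⟨ +-≋ˡ (toℕ g) (%-≋ (suc o')) ⟩
    (toℕ g + suc o') % n       ≡⟨ cong (_% n) (+-assoc (toℕ g) 1 o') ⟨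
    (toℕ g + 1 + o') % n       ≡⟨ +-≋ʳ o' (sym (trans (cong (_% n) g'≡g+1) (%-≋ (toℕ g + 1)))) ⟩
    (toℕ g' + o') % n          ≡⟨ offset-spec c (toℕ≤n g') ⟩
    c % n                      ∎)
    where
    open ≡-Reasoning
    o' = offset (toℕ g') c

  cycleDist-step : ∀ {g g'} c → CycAdj n g g' → cycleDist g c ≤ suc (cycleDist g' c)
  cycleDist-step {g} {g'} c (inj₁ g'≡g+1) =
    subst (λ r → norm r ≤ suc (cycleDist g' c)) (sym (offset-adj (toℕ c) g'≡g+1))
      (proj₂ (norm-suc (offset<n (toℕ g') (toℕ c))))
  cycleDist-step {g} {g'} c (inj₂ g≡g'+1) =
    subst (λ r → cycleDist g c ≤ suc (norm r)) (sym (offset-adj (toℕ c) g≡g'+1))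
      (proj₁ (norm-suc (offset<n (toℕ g) (toℕ c))))

  cycAdj-sym : ∀ {g h} → CycAdj n g h → CycAdj n h g
  cycAdj-sym (inj₁ e) = inj₂ e
  cycAdj-sym (inj₂ e) = inj₁ e

  cycle-walk : ∀ (g h : Fin n) r → toℕ g + r ≋ toℕ h → Walk (CycAdj n) g h r
  cycle-walk g h zero g≋h = subst (λ h′ → Walk (CycAdj n) g h′ 0)
    (toℕ-injective (≋⇒≡ (toℕ<n g) (toℕ<n h) (trans (cong (_% n) (sym (+-identityʳ (toℕ g)))) g≋h))) here
  cycle-walk g h (suc r) g+r≋h = step (inj₁ (toℕ-fromℕ< _)) (cycle-walk ((toℕ g + 1) mod n) h r (begin
    (toℕ ((toℕ g + 1) mod n) + r) % n   ≡⟨ +-≋ʳ r (toℕ-mod (toℕ g + 1)) ⟩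
    (toℕ g + 1 + r) % n                 ≡⟨ cong (_% n) (+-assoc (toℕ g) 1 r) ⟩
    (toℕ g + suc r) % n                 ≡⟨ g+r≋h ⟩
    toℕ h % n                           ∎))
    where open ≡-Reasoning

  cycleDist-walk : ∀ g h → Walk (CycAdj n) g h (cycleDist g h)
  cycleDist-walk g h = walk-of-norm (offset-spec (toℕ h) (toℕ≤n g)) (<⇒≤ (offset<n (toℕ g) (toℕ h)))
    where
    walk-of-norm : ∀ {o} → toℕ g + o ≋ toℕ h → o ≤ n → Walk (CycAdj n) g h (norm o)
    walk-of-norm {o} g+o≋h o≤n with ⊓-sel o (n ∸ o)
    ... | inj₁ norm≡o = subst (Walk _ g h) (sym norm≡o) (cycle-walk g h o g+o≋h)
    ... | inj₂ norm≡n∸o = subst (Walk _ g h) (sym norm≡n∸o)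
      (walk-reverse cycAdj-sym (cycle-walk h g (n ∸ o) (begin
        (toℕ h + (n ∸ o)) % n       ≡⟨ +-≋ʳ (n ∸ o) (sym g+o≋h) ⟩
        (toℕ g + o + (n ∸ o)) % n   ≡⟨ cong (_% n) (+-assoc (toℕ g) o (n ∸ o)) ⟩
        (toℕ g + (o + (n ∸ o))) % n ≡⟨ cong (λ m → (toℕ g + m) % n) (m+[n∸m]≡n o≤n) ⟩
        (toℕ g + n) % n             ≡⟨ +n-≋ (toℕ g) ⟩
        toℕ g % n                   ∎)))
      where open ≡-Reasoning

  cycleDist-self : ∀ g → cycleDist g g ≡ 0
  cycleDist-self g = cong norm (offset-unique (toℕ≤n g) (>-nonZero⁻¹ n) (cong (_% n) (+-identityʳ (toℕ g))))

  rung-walk : ∀ g h h' → Walk (PrismAdj n) (g , h) (g , h') (bitDist h h')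
  rung-walk g zero       zero       = here
  rung-walk g zero       (suc zero) = step (inj₁ (refl , λ ())) here
  rung-walk g (suc zero) zero       = step (inj₁ (refl , λ ())) here
  rung-walk g (suc zero) (suc zero) = here

  layer-walk : ∀ {g g' k} h → Walk (CycAdj n) g g' k → Walk (PrismAdj n) (g , h) (g' , h) k
  layer-walk h here       = here
  layer-walk h (step e w) = step (inj₂ (refl , e)) (layer-walk h w)

  prismDist : Vtx n → Vtx n → ℕ
  prismDist (g , h) (g' , h') = cycleDist g g' + bitDist h h'

  prismDist-step : ∀ {p p'} x → PrismAdj n p p' → prismDist p x ≤ suc (prismDist p' x)
  prismDist-step {g , h} {.g , h'} (c , z) (inj₁ (refl , _)) =
    subst (cycleDist g c + bitDist h z ≤_) (+-suc (cycleDist g c) (bitDist h' z))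
      (+-monoʳ-≤ (cycleDist g c) (≤-trans (bitDist≤1 h z) (s≤s z≤n)))
  prismDist-step {g , h} {g' , .h} (c , z) (inj₂ (refl , e)) = +-monoˡ-≤ (bitDist h z) (cycleDist-step c e)

  prismDist-walk : ∀ p q → Walk (PrismAdj n) p q (prismDist p q)
  prismDist-walk (g , h) (g' , h') = walk-++ (layer-walk h (cycleDist-walk g g')) (rung-walk g' h h')

  prismDist-self : ∀ p → prismDist p p ≡ 0
  prismDist-self (g , h) = cong₂ _+_ (cycleDist-self g) (bitDist-self h)

  Dist⇔≡prismDist : ∀ {p q k} → Dist n p q k ⇔ (k ≡ prismDist p q)
  Dist⇔≡prismDist = IsDist⇔≡ prismDist prismDist-self prismDist-step prismDist-walk

  InBisector⇔ : ∀ v w x → InBisector n v w x ⇔ (prismDist v x ≡ prismDist w x)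
  InBisector⇔ v w x = mk⇔
    (λ { (k , v→x , w→x) → trans (sym (to Dist⇔≡prismDist v→x)) (to Dist⇔≡prismDist w→x) })
    (λ eq → prismDist v x , from Dist⇔≡prismDist refl , from Dist⇔≡prismDist eq)
    where open Equivalence

  InBisector-transfer : ∀ {g h g' h' : Fin n} {i j : Fin 2} → i ≢ j → ∀ t z →
    (cycleDist g t + 1 ≡ cycleDist h t) ⇔ (cycleDist g' t + 1 ≡ cycleDist h' t) →
    (cycleDist g t ≡ cycleDist h t + 1) ⇔ (cycleDist g' t ≡ cycleDist h' t + 1) →
    InBisector n (g , i) (h , j) (t , z) ⇔ InBisector n (g' , i) (h' , j) (t , z)
  InBisector-transfer i≢j t z closer-to-g closer-to-h =
    ⇔.trans (InBisector⇔ _ _ (t , z))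
      (⇔.trans (bitDist-balance-transfer i≢j closer-to-g closer-to-h z) (⇔.sym (InBisector⇔ _ _ (t , z))))

  cycleDist-via : ∀ {a p : Fin n} c t → c + toℕ p ≋ toℕ a →
                  cycleDist p t ≡ norm ((offset (toℕ a) (toℕ t) + c) % n)
  cycleDist-via {a} {p} c t c+p≋a = cong norm (offset-shift (toℕ t) c (toℕ≤n a) (toℕ≤n p) c+p≋a)

  layers-differ : ∀ {xv xw : Fin n} {yv yw : Fin 2} → 2 ∣ n → InA n (xv , yv) → InA n (xw , yw) →
                  toℕ xw ≋ toℕ xv + 3 → yv ≢ yw
  layers-differ {xv} {xw} {yv} 2∣n v∈A w∈A xw≋xv+3 refl = 0≢1+n (begin
    0                      ≡⟨ w∈A ⟨
    (toℕ xw + 1 + y) % 2   ≡⟨ ≋⇒≡mod2 (+-≋ʳ y (+-≋ʳ 1 xw≋xv+3)) ⟩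
    (toℕ xv + 3 + 1 + y) % 2 ≡⟨ cong (_% 2) (regroup (toℕ xv) y) ⟩
    (W + 3) % 2            ≡⟨ %-distribˡ-+ W 3 2 ⟩
    (W % 2 + 1) % 2        ≡⟨ cong (λ r → (r + 1) % 2) v∈A ⟩
    1                      ∎)
    where
    open ≡-Reasoning
    y = toℕ yv + 1
    W = toℕ xv + 1 + y
    ≋⇒≡mod2 : ∀ {x x'} → x ≋ x' → x % 2 ≡ x' % 2
    ≋⇒≡mod2 {x} {x'} x≋x' =
      trans (sym (m∣n⇒o%n%m≡o%m 2 n x 2∣n)) (trans (cong (_% 2) x≋x') (m∣n⇒o%n%m≡o%m 2 n x' 2∣n))
    regroup : ∀ a b → a + 3 + 1 + b ≡ a + 1 + b + 3
    regroup = solve-∀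

double-injective : ∀ {x y} → x + x ≡ y + y → x ≡ y
double-injective {x} {y} eq with <-cmp x y
... | tri< x<y _ _ = contradiction eq (<⇒≢ (+-mono-< x<y x<y))
... | tri≈ _ x≡y _ = x≡y
... | tri> _ _ x>y = contradiction (sym eq) (<⇒≢ (+-mono-< x>y x>y))

cancel-common : ∀ {a b} x c d → a ≡ b → a ≡ x + c → b ≡ x + d → c ≡ d
cancel-common x c d a≡b a≡x+c b≡x+d = +-cancelˡ-≡ x c d (trans (sym a≡x+c) (trans a≡b b≡x+d))

module SymmetricPair (n : ℕ) ⦃ _ : NonZero n ⦄ (s e : ℕ) (n≡ : n ≡ 6 + s + s + 4 * e) where
  open Residues n
  open Prism n

  k : ℕ
  k = n ∸ (3 + s)

  k≡ : k ≡ 3 + s + 4 * e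
  k≡ = trans (cong (_∸ (3 + s)) (trans n≡ (regroup s e))) (m+n∸n≡m _ (3 + s))
    where
    regroup : ∀ s e → 6 + s + s + 4 * e ≡ (3 + s + 4 * e) + (3 + s)
    regroup = solve-∀

  k+3+s≡n : k + (3 + s) ≡ n
  k+3+s≡n = trans (cong (_+ (3 + s)) k≡) (sym (trans n≡ (solve (s ∷ e ∷ []))))

  2∣n : 2 ∣ n
  2∣n = divides (3 + s + 2 * e) (trans n≡ (solve (s ∷ e ∷ [])))

  -- For t at offset u from a, with p = a − s and q = a + 3 + s: dp u = d(p, t), dq u = d(q, t).
  dp dq : ℕ → ℕ
  dp u = norm ((u + s) % n)
  dq u = norm ((u + k) % n)

  ≤n-by : ∀ x d → x + d ≡ 6 + s + s + 4 * e → x ≤ n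
  ≤n-by x d eq = subst (x ≤_) (trans eq (sym n≡)) (m≤m+n x d)

  <n-by : ∀ x d → x + suc d ≡ 6 + s + s + 4 * e → x < n
  <n-by x d eq = ≤n-by (suc x) d (trans (sym (+-suc x d)) eq)

  n≤-by : ∀ y d → 6 + s + s + 4 * e + d ≡ y → n ≤ y
  n≤-by y d eq = subst (_≤ y) (sym n≡) (subst (_ ≤_) eq (m≤m+n _ d))

  3+s≤n : 3 + s ≤ n
  3+s≤n = ≤n-by (3 + s) (3 + s + 4 * e) (solve (s ∷ e ∷ []))

  s≤n : s ≤ n
  s≤n = ≤-trans (m≤n+m s 3) 3+s≤n

  dp-low : ∀ {u} → u + s < n → (u + s) + (u + s) ≤ n → dp u ≡ u + s
  dp-low u+s<n low = trans (cong norm (m<n⇒m%n≡m u+s<n)) (norm-low low)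

  dp-high : ∀ {u} → u + s < n → n ≤ (u + s) + (u + s) → dp u + (u + s) ≡ n
  dp-high {u} u+s<n high =
    subst (λ x → norm x + (u + s) ≡ n) (sym (m<n⇒m%n≡m u+s<n)) (norm-high high (<⇒≤ u+s<n))

  3+s≤k : 3 + s ≤ k
  3+s≤k = subst (3 + s ≤_) (sym k≡) (m≤m+n (3 + s) (4 * e))

  dq-low : ∀ {u r} → (u + k) % n ≡ r → r + r ≤ n → dq u ≡ r
  dq-low res low = trans (cong norm res) (norm-low low)

  dq-high : ∀ {u r} → (u + k) % n ≡ r → n ≤ r + r → r ≤ n → dq u + r ≡ n
  dq-high {u} res high r≤n = subst (λ x → norm x + _ ≡ n) (sym res) (norm-high high r≤n)

  dq-before-q : ∀ {u r} → u < 3 + s → u + r ≡ 3 + s → dq u ≡ r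
  dq-before-q {u} {r} u<3+s u+r≡ = +-cancelʳ-≡ (u + k) (dq u) r (begin
    dq u + (u + k)   ≡⟨ dq-high (m<n⇒m%n≡m u+k<n) n≤2[u+k] (<⇒≤ u+k<n) ⟩
    n                ≡⟨ k+3+s≡n ⟨
    k + (3 + s)      ≡⟨ cong (k +_) u+r≡ ⟨
    k + (u + r)      ≡⟨ swap-outer k u r ⟩
    r + (u + k)      ∎)
    where
    open ≡-Reasoning
    swap-outer : ∀ a b c → a + (b + c) ≡ c + (b + a)
    swap-outer = solve-∀
    u+k<n : u + k < n
    u+k<n = subst (u + k <_) (trans (+-comm (3 + s) k) k+3+s≡n) (+-monoˡ-< k u<3+s)
    n≤2[u+k] : n ≤ (u + k) + (u + k)
    n≤2[u+k] = subst (_≤ (u + k) + (u + k)) k+3+s≡n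
      (+-mono-≤ (m≤n+m k u) (≤-trans 3+s≤k (m≤n+m k u)))

  residue-beyond-q : ∀ {u r} → u ≡ 3 + s + r → r < n → (u + k) % n ≡ r
  residue-beyond-q {u} {r} u≡ r<n = begin
    (u + k) % n              ≡⟨ cong (λ x → (x + k) % n) u≡ ⟩
    (3 + s + r + k) % n      ≡⟨ cong (_% n) (rearrange (3 + s) r k) ⟩
    (r + (k + (3 + s))) % n  ≡⟨ cong (λ x → (r + x) % n) k+3+s≡n ⟩
    (r + n) % n              ≡⟨ +n-≋ r ⟩
    r % n                    ≡⟨ m<n⇒m%n≡m r<n ⟩
    r                        ∎
    where
    open ≡-Reasoning
    rearrange : ∀ a b c → a + b + c ≡ b + (c + a)
    rearrange = solve-∀

  -- The constructor names the arc containing t (aq: from a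
  -- up to q, out: from q up to p, pa: from p up to a); the index tells whether the geodesics from
  -- p and q to t run up or down.
  data Position (u x y : ℕ) : Set where
    aq₁  : ∀ r → u + r ≡ 3 + s → x ≡ u + s → y ≡ r → Position u x y
    aq₂  : ∀ r → u + r ≡ 3 + s → x + (u + s) ≡ n → y ≡ r → Position u x y
    out₁ : ∀ r → u ≡ 3 + s + r → x ≡ u + s → y ≡ r → Position u x y
    out₂ : ∀ r → u ≡ 3 + s + r → x + (u + s) ≡ n → y ≡ r → Position u x y
    out₃ : ∀ r → u ≡ 3 + s + r → x + (u + s) ≡ n → y + r ≡ n → Position u x y
    pa₁  : ∀ r q → q + 3 + 4 * e ≡ r → q < s → x ≡ q → y ≡ r → Position u x y
    pa₂  : ∀ r q → q + 3 + 4 * e ≡ r → q < s → x ≡ q → y + r ≡ n → Position u x y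

  position-aq : ∀ {u} → u < 3 + s → Position u (dp u) (dq u)
  position-aq {u} u<3+s = by-dp ((u + s) + (u + s) ≤? n)
    where
    r = 3 + s ∸ u
    u+r≡3+s : u + r ≡ 3 + s
    u+r≡3+s = m+[n∸m]≡n (<⇒≤ u<3+s)
    u+s<n : u + s < n
    u+s<n = <-≤-trans (+-monoˡ-< s u<3+s) (≤n-by (3 + s + s) (3 + 4 * e) (solve (s ∷ e ∷ [])))
    by-dp : Dec ((u + s) + (u + s) ≤ n) → Position u (dp u) (dq u)
    by-dp (yes low)  = aq₁ r u+r≡3+s (dp-low u+s<n low) (dq-before-q u<3+s u+r≡3+s)
    by-dp (no ¬low) = aq₂ r u+r≡3+s (dp-high u+s<n (<⇒≤ (≰⇒> ¬low))) (dq-before-q u<3+s u+r≡3+s)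

  position-out : ∀ {u} → u < n → 3 + s ≤ u → u + s < n → Position u (dp u) (dq u)
  position-out {u} u<n 3+s≤u u+s<n = by-dp ((u + s) + (u + s) ≤? n)
    where
    r = u ∸ (3 + s)
    u≡3+s+r : u ≡ 3 + s + r
    u≡3+s+r = sym (m+[n∸m]≡n 3+s≤u)
    r<n : r < n
    r<n = ≤-<-trans (m∸n≤m u (3 + s)) u<n
    residue : (u + k) % n ≡ r
    residue = residue-beyond-q u≡3+s+r r<n
    r≤u+s : r ≤ u + s
    r≤u+s = ≤-trans (m∸n≤m u (3 + s)) (m≤m+n u s)
    by-dq : n ≤ (u + s) + (u + s) → Dec (r + r ≤ n) → Position u (dp u) (dq u)
    by-dq high (yes low) = out₂ r u≡3+s+r (dp-high u+s<n high) (dq-low residue low)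
    by-dq high (no ¬low) =
      out₃ r u≡3+s+r (dp-high u+s<n high) (dq-high residue (<⇒≤ (≰⇒> ¬low)) (<⇒≤ r<n))
    by-dp : Dec ((u + s) + (u + s) ≤ n) → Position u (dp u) (dq u)
    by-dp (yes low) =
      out₁ r u≡3+s+r (dp-low u+s<n low) (dq-low residue (≤-trans (+-mono-≤ r≤u+s r≤u+s) low))
    by-dp (no ¬low) = by-dq (<⇒≤ (≰⇒> ¬low)) (r + r ≤? n)

  position-pa : ∀ {u} → u < n → 3 + s ≤ u → n ≤ u + s → Position u (dp u) (dq u)
  position-pa {u} u<n 3+s≤u n≤u+s = by-dq (r + r ≤? n)
    where
    r = u ∸ (3 + s)
    u≡3+s+r : u ≡ 3 + s + r
    u≡3+s+r = sym (m+[n∸m]≡n 3+s≤u)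
    r<n : r < n
    r<n = ≤-<-trans (m∸n≤m u (3 + s)) u<n
    residue : (u + k) % n ≡ r
    residue = residue-beyond-q u≡3+s+r r<n
    q = (u + s) % n
    s<n : s < n
    s<n = <n-by s (5 + s + 4 * e) (solve (s ∷ e ∷ []))
    q+n≡u+s : q + n ≡ u + s
    q+n≡u+s = x%n+n≡x n≤u+s (+-mono-< u<n s<n)
    q<s : q < s
    q<s = +-cancelʳ-< n q s (subst (_< s + n) (sym q+n≡u+s) (subst (u + s <_) (+-comm n s) (+-monoˡ-< s u<n)))
    q+3+4e≡r : q + 3 + 4 * e ≡ r
    q+3+4e≡r = +-cancelʳ-≡ (3 + s + s) (q + 3 + 4 * e) r (begin
      q + 3 + 4 * e + (3 + s + s)   ≡⟨ regroupˡ q s e ⟩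
      q + (6 + s + s + 4 * e)       ≡⟨ cong (q +_) n≡ ⟨
      q + n                         ≡⟨ q+n≡u+s ⟩
      u + s                         ≡⟨ cong (_+ s) u≡3+s+r ⟩
      3 + s + r + s                 ≡⟨ regroupʳ s r ⟩
      r + (3 + s + s)               ∎)
      where
      open ≡-Reasoning
      regroupˡ : ∀ q s e → q + 3 + 4 * e + (3 + s + s) ≡ q + (6 + s + s + 4 * e)
      regroupˡ = solve-∀
      regroupʳ : ∀ s r → 3 + s + r + s ≡ r + (3 + s + s)
      regroupʳ = solve-∀
    dp≡q : dp u ≡ q
    dp≡q = norm-low (≤-trans (<⇒≤ (+-mono-< q<s q<s))
                             (≤n-by (s + s) (6 + 4 * e) (solve (s ∷ e ∷ []))))
    by-dq : Dec (r + r ≤ n) → Position u (dp u) (dq u)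
    by-dq (yes low) = pa₁ r q q+3+4e≡r q<s dp≡q (dq-low residue low)
    by-dq (no ¬low) = pa₂ r q q+3+4e≡r q<s dp≡q (dq-high residue (<⇒≤ (≰⇒> ¬low)) (<⇒≤ r<n))

  position : ∀ {u} → u < n → Position u (dp u) (dq u)
  position {u} u<n with u <? 3 + s | u + s <? n
  ... | yes u<3+s | _         = position-aq u<3+s
  ... | no u≮3+s  | yes u+s<n = position-out u<n (≮⇒≥ u≮3+s) u+s<n
  ... | no u≮3+s  | no u+s≮n  = position-pa u<n (≮⇒≥ u≮3+s) (≮⇒≥ u+s≮n)

  closer-to-p : ∀ {u x y} → Position u x y → x + 1 ≡ y → u ≡ 1 ⊎ u + u ≡ n + 4
  closer-to-p {u} (aq₁ _ u+r≡3+s refl refl) refl =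
    inj₁ (double-injective
      (cancel-common (s + 1) (u + u) 2 u+r≡3+s (solve (u ∷ s ∷ [])) (solve (s ∷ []))))
  closer-to-p {u} {x} (aq₂ _ u+r≡3+s x+u+s≡n refl) refl = contradiction
    (cancel-common (s + s) 3 (7 + 4 * e) (begin
      3 + s + s            ≡⟨ cong (_+ s) u+r≡3+s ⟨
      u + (x + 1) + s      ≡⟨ solve (u ∷ x ∷ s ∷ []) ⟩
      x + (u + s) + 1      ≡⟨ cong (_+ 1) (trans x+u+s≡n n≡) ⟩
      6 + s + s + 4 * e + 1 ∎) (solve (s ∷ [])) (solve (s ∷ e ∷ [])))
    λ ()
    where open ≡-Reasoning
  closer-to-p (out₁ r refl refl refl) eq =
    contradiction (cancel-common r (4 + s + s) 0 eq (solve (r ∷ s ∷ [])) (solve (r ∷ []))) λ ()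
  closer-to-p {x = x} (out₂ _ refl x+u+s≡n refl) refl =
    inj₂ (trans twice-u (cong (_+ 4) x+u+s≡n))
    where
    twice-u : 3 + s + (x + 1) + (3 + s + (x + 1)) ≡ x + (3 + s + (x + 1) + s) + 4
    twice-u = solve (x ∷ s ∷ [])
  closer-to-p {x = x} (out₃ r refl x+u+s≡n x+1+r≡n) refl = contradiction
    (cancel-common (x + r) 1 (3 + s + s) (trans x+1+r≡n (sym x+u+s≡n))
      (solve (x ∷ r ∷ [])) (solve (x ∷ r ∷ s ∷ [])))
    λ ()
  closer-to-p (pa₁ _ q refl _ refl refl) eq =
    contradiction (cancel-common q 1 (3 + 4 * e) eq (solve (q ∷ [])) (solve (q ∷ e ∷ []))) λ ()
  closer-to-p (pa₂ _ q refl q<s refl q+1+r≡n) refl =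
    contradiction q<s (≤⇒≯ (≤-trans (n≤1+n s) (≤-reflexive (sym q≡1+s))))
    where
    q≡1+s : q ≡ 1 + s
    q≡1+s = double-injective (cancel-common (4 + 4 * e) (q + q) (1 + s + (1 + s))
      (trans q+1+r≡n n≡) (solve (q ∷ e ∷ [])) (solve (s ∷ e ∷ [])))

  closer-to-q : ∀ {u x y} → Position u x y → x ≡ y + 1 → u ≡ 2 ⊎ u + u ≡ n + 2
  closer-to-q {u} (aq₁ r u+r≡3+s refl refl) eq =
    inj₁ (double-injective (cancel-common (r + s) (u + u) 4 (cong₂ _+_ eq u+r≡3+s)
      (solve (u ∷ r ∷ s ∷ [])) (solve (r ∷ s ∷ []))))
  closer-to-q {u} (aq₂ r u+r≡3+s r+1+u+s≡n refl) refl = contradiction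
    (cancel-common (s + s) 4 (6 + 4 * e) (begin
      4 + s + s            ≡⟨ cong (λ z → 1 + (z + s)) u+r≡3+s ⟨
      1 + (u + r + s)      ≡⟨ solve (u ∷ r ∷ s ∷ []) ⟩
      r + 1 + (u + s)      ≡⟨ trans r+1+u+s≡n n≡ ⟩
      6 + s + s + 4 * e    ∎) (solve (s ∷ [])) (solve (s ∷ e ∷ [])))
    λ ()
    where open ≡-Reasoning
  closer-to-q (out₁ r refl refl refl) eq =
    contradiction (cancel-common r (3 + s + s) 1 eq (solve (r ∷ s ∷ [])) (solve (r ∷ []))) λ ()
  closer-to-q (out₂ r refl r+1+u+s≡n refl) refl =
    inj₂ (trans twice-u (cong (_+ 2) r+1+u+s≡n))
    where
    twice-u : 3 + s + r + (3 + s + r) ≡ r + 1 + (3 + s + r + s) + 2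
    twice-u = solve (r ∷ s ∷ [])
  closer-to-q {y = y} (out₃ r refl y+1+u+s≡n y+r≡n) refl = contradiction
    (cancel-common (y + r) 0 (4 + s + s) (trans y+r≡n (sym y+1+u+s≡n))
      (solve (y ∷ r ∷ [])) (solve (y ∷ r ∷ s ∷ [])))
    λ ()
  closer-to-q (pa₁ _ q refl _ refl refl) eq =
    contradiction (cancel-common q 0 (4 + 4 * e) eq (solve (q ∷ [])) (solve (q ∷ e ∷ []))) λ ()
  closer-to-q {y = y} (pa₂ _ _ refl q<s refl y+r≡n) refl =
    contradiction q<s (≤⇒≯ (≤-trans (n≤1+n s) (subst (_≤ y + 1) y≡1+s (m≤m+n y 1))))
    where
    y≡1+s : y ≡ 1 + s
    y≡1+s = double-injective (cancel-common (4 + 4 * e) (y + y) (1 + s + (1 + s))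
      (trans y+r≡n n≡) (solve (y ∷ e ∷ [])) (solve (s ∷ e ∷ [])))

  closer-to-p-at-1 : dp 1 + 1 ≡ dq 1
  closer-to-p-at-1 = begin
    dp 1 + 1    ≡⟨ cong (_+ 1) (dp-low (<n-by (1 + s) (4 + s + 4 * e) (solve (s ∷ e ∷ [])))
                                        (≤n-by (1 + s + (1 + s)) (4 + 4 * e) (solve (s ∷ e ∷ [])))) ⟩
    1 + s + 1   ≡⟨ +-comm (1 + s) 1 ⟩
    2 + s       ≡⟨ dq-before-q (s≤s (s≤s z≤n)) refl ⟨
    dq 1        ∎
    where open ≡-Reasoning

  closer-to-q-at-2 : dp 2 ≡ dq 2 + 1
  closer-to-q-at-2 = begin
    dp 2        ≡⟨ dp-low (<n-by (2 + s) (3 + s + 4 * e) (solve (s ∷ e ∷ [])))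
                          (≤n-by (2 + s + (2 + s)) (2 + 4 * e) (solve (s ∷ e ∷ []))) ⟩
    2 + s       ≡⟨ +-comm 1 (1 + s) ⟩
    1 + s + 1   ≡⟨ cong (_+ 1) (dq-before-q (s≤s (s≤s (s≤s z≤n))) refl) ⟨
    dq 2 + 1    ∎
    where open ≡-Reasoning

  closer-to-p-antipodal : ∀ {u} → u + u ≡ n + 4 → dp u + 1 ≡ dq u
  closer-to-p-antipodal {u} u+u≡n+4 = subst (λ v → dp v + 1 ≡ dq v) (sym u≡) (begin
    dp (5 + s + 2 * e) + 1   ≡⟨ cong (_+ 1) dp≡ ⟩
    1 + 2 * e + 1            ≡⟨ +-comm (1 + 2 * e) 1 ⟩
    2 + 2 * e                ≡⟨ dq≡ ⟨
    dq (5 + s + 2 * e)       ∎)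
    where
    open ≡-Reasoning
    u≡ : u ≡ 5 + s + 2 * e
    u≡ = double-injective (trans u+u≡n+4 (trans (cong (_+ 4) n≡) (solve (s ∷ e ∷ []))))
    dp≡ : dp (5 + s + 2 * e) ≡ 1 + 2 * e
    dp≡ = +-cancelʳ-≡ (5 + s + 2 * e + s) _ _ (trans
      (dp-high (<n-by (5 + s + 2 * e + s) (2 * e) (solve (s ∷ e ∷ [])))
               (n≤-by _ (4 + s + s) (solve (s ∷ e ∷ []))))
      (trans n≡ (solve (s ∷ e ∷ []))))
    dq≡ : dq (5 + s + 2 * e) ≡ 2 + 2 * e
    dq≡ = dq-low (residue-beyond-q (solve (s ∷ e ∷ []))
                   (<n-by (2 + 2 * e) (3 + s + s + 2 * e) (solve (s ∷ e ∷ []))))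
                 (≤n-by (2 + 2 * e + (2 + 2 * e)) (2 + s + s) (solve (s ∷ e ∷ [])))

  closer-to-q-antipodal : ∀ {u} → u + u ≡ n + 2 → dp u ≡ dq u + 1
  closer-to-q-antipodal {u} u+u≡n+2 = subst (λ v → dp v ≡ dq v + 1) (sym u≡) (begin
    dp (4 + s + 2 * e)       ≡⟨ dp≡ ⟩
    2 + 2 * e                ≡⟨ +-comm 1 (1 + 2 * e) ⟩
    1 + 2 * e + 1            ≡⟨ cong (_+ 1) dq≡ ⟨
    dq (4 + s + 2 * e) + 1   ∎)
    where
    open ≡-Reasoning
    u≡ : u ≡ 4 + s + 2 * e
    u≡ = double-injective (trans u+u≡n+2 (trans (cong (_+ 2) n≡) (solve (s ∷ e ∷ []))))
    dp≡ : dp (4 + s + 2 * e) ≡ 2 + 2 * e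
    dp≡ = +-cancelʳ-≡ (4 + s + 2 * e + s) _ _ (trans
      (dp-high (<n-by (4 + s + 2 * e + s) (1 + 2 * e) (solve (s ∷ e ∷ [])))
               (n≤-by _ (2 + s + s) (solve (s ∷ e ∷ []))))
      (trans n≡ (solve (s ∷ e ∷ []))))
    dq≡ : dq (4 + s + 2 * e) ≡ 1 + 2 * e
    dq≡ = dq-low (residue-beyond-q (solve (s ∷ e ∷ []))
                   (<n-by (1 + 2 * e) (4 + s + s + 2 * e) (solve (s ∷ e ∷ []))))
                 (≤n-by (1 + 2 * e + (1 + 2 * e)) (4 + s + s) (solve (s ∷ e ∷ [])))

  closer-to-p⇔ : ∀ {u} → u < n → (dp u + 1 ≡ dq u) ⇔ (u ≡ 1 ⊎ u + u ≡ n + 4)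
  closer-to-p⇔ u<n = mk⇔ (closer-to-p (position u<n))
    λ { (inj₁ refl) → closer-to-p-at-1 ; (inj₂ u+u≡n+4) → closer-to-p-antipodal u+u≡n+4 }

  closer-to-q⇔ : ∀ {u} → u < n → (dp u ≡ dq u + 1) ⇔ (u ≡ 2 ⊎ u + u ≡ n + 2)
  closer-to-q⇔ u<n = mk⇔ (closer-to-q (position u<n))
    λ { (inj₁ refl) → closer-to-q-at-2 ; (inj₂ u+u≡n+2) → closer-to-q-antipodal u+u≡n+2 }

  module _ {a p q : Fin n} (s+p≋a : s + toℕ p ≋ toℕ a) (k+q≋a : k + toℕ q ≋ toℕ a)
           (t : Fin n) where

    private
      u = offset (toℕ a) (toℕ t)

    cycleDist-closer-to-p⇔ : (cycleDist p t + 1 ≡ cycleDist q t) ⇔ (u ≡ 1 ⊎ u + u ≡ n + 4)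
    cycleDist-closer-to-p⇔ = subst₂ (λ x y → (x + 1 ≡ y) ⇔ (u ≡ 1 ⊎ u + u ≡ n + 4))
      (sym (cycleDist-via s t s+p≋a)) (sym (cycleDist-via k t k+q≋a))
      (closer-to-p⇔ (offset<n (toℕ a) (toℕ t)))

    cycleDist-closer-to-q⇔ : (cycleDist p t ≡ cycleDist q t + 1) ⇔ (u ≡ 2 ⊎ u + u ≡ n + 2)
    cycleDist-closer-to-q⇔ = subst₂ (λ x y → (x ≡ y + 1) ⇔ (u ≡ 2 ⊎ u + u ≡ n + 2))
      (sym (cycleDist-via s t s+p≋a)) (sym (cycleDist-via k t k+q≋a))
      (closer-to-q⇔ (offset<n (toℕ a) (toℕ t)))

mod4≡2-split : ∀ {n l} → n % 4 ≡ 2 → l < n / 4 → ∃[ e ] n ≡ 6 + 2 * l + 2 * l + 4 * e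
mod4≡2-split {n} {l} n%4≡2 l<n/4 = e , (begin
  n                       ≡⟨ m≡m%n+[m/n]*n n 4 ⟩
  n % 4 + n / 4 * 4       ≡⟨ cong₂ (λ r m → r + m * 4) (sym n%4≡2) (m+[n∸m]≡n l<n/4) ⟨
  2 + (suc l + e) * 4     ≡⟨ regroup l e ⟩
  6 + 2 * l + 2 * l + 4 * e ∎)
  where
  open ≡-Reasoning
  e = n / 4 ∸ suc l
  regroup : ∀ l e → 2 + (suc l + e) * 4 ≡ 6 + 2 * l + 2 * l + 4 * e
  regroup = solve-∀

mainTheorem14 : (n : ℕ) → ⦃ _ : NonZero n ⦄ → 6 ≤ n → n % 4 ≡ 2 →
    (v w : Vtx n) → InA n v → InA n w → CycDist n (proj₁ v) (proj₁ w) 3 →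
    proj₁ w ≡ shiftUp n (proj₁ v) 3 →
    (l : ℕ) → l < n / 4 →
    (x : Vtx n) →
      InBisector n v w x ⇔
      InBisector n (shiftDown n (proj₁ v) (2 * l) , proj₂ v) (shiftUp n (proj₁ w) (2 * l) , proj₂ w) x
mainTheorem14 n _ n%4≡2 (a , yv) (b , yw) v∈A w∈A _ b≡a+3 l l<n/4 (t , z) with mod4≡2-split n%4≡2 l<n/4
... | e , n≡ = InBisector-transfer (layers-differ S₂.2∣n v∈A w∈A b≋a+3) t z
  (⇔.trans (S₀.cycleDist-closer-to-p⇔ refl q₀≋a t) (⇔.sym (S₂.cycleDist-closer-to-p⇔ p₂≋a q₂≋a t)))
  (⇔.trans (S₀.cycleDist-closer-to-q⇔ refl q₀≋a t) (⇔.sym (S₂.cycleDist-closer-to-q⇔ p₂≋a q₂≋a t)))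
  where
  open Residues n
  open Prism n
  regroup : ∀ l e → 6 + 2 * l + 2 * l + 4 * e ≡ 6 + 0 + 0 + 4 * (l + e)
  regroup = solve-∀
  module S₀ = SymmetricPair n 0 (l + e) (trans n≡ (regroup l e))
  module S₂ = SymmetricPair n (2 * l) e n≡
  b≋a+3 : toℕ b ≋ toℕ a + 3
  b≋a+3 = trans (cong (λ x → toℕ x % n) b≡a+3) (toℕ-shiftUp a 3)
  q₀≋a : n ∸ 3 + toℕ b ≋ toℕ a
  q₀≋a = complement-≋ S₀.3+s≤n b≋a+3
  p₂≋a : 2 * l + toℕ (shiftDown n a (2 * l)) ≋ toℕ a
  p₂≋a = toℕ-shiftDown a S₂.s≤n
  q₂≋a : n ∸ (3 + 2 * l) + toℕ (shiftUp n b (2 * l)) ≋ toℕ a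
  q₂≋a = complement-≋ S₂.3+s≤n (trans (toℕ-shiftUp b (2 * l))
           (trans (+-≋ʳ (2 * l) b≋a+3) (cong (_% n) (+-assoc (toℕ a) 3 (2 * l)))))
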